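{- Let $t$ be the word transduction on $\{a,b\}^*$ described in the context. There is a function $n:\mathbb N\to\mathbb N$ with $n(k)=O(\log k)$ such that for every $k$ and every word $u\in\{a,b\}^*$ of length $k$, the iterate $t^{n(k)}(u)$ is a prefix of the infinite word $ababab\cdots=(ab)^\omega$.
   Context: The deterministic transducer has states $00,10,20,11,12,21,22$ with initial state $00$. Its transitions, written "state --input|output--> new state" with $\epsilon$ the empty word, are: - $00$ --$a|\epsilon$--> $10$; $00$ --$b|\epsilon$--> $11$; - $10$ --$a|\epsilon$--> $20$; $10$ --$b|\epsilon$--> $21$; - $20$ --$a|\epsilon$--> $11$; $20$ --$b|\epsilon$--> $12$; - $11$ --$a|\epsilon$--> $21$; $11$ --$b|\epsilon$--> $22$; - $21$ --$a|a$--> $12$; $21$ --$b|ab$--> $11$; - $12$ --$a|\epsilon$--> $22$; $12$ --$b|b$--> $21$; - $22$ --$a|ba$--> $11$; $22$ --$b|ba$--> $12$. For $u\in\{a,b\}^*$, $t(u)$ is the concatenation of the outputs along the path that starts at $00$ and reads $u$ letter by letter. The iterates are $t^0(u)=u$ and $t^{n+1}(u)=t(t^n(u))$. -}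

module Defs where

open import Data.Nat using (ℕ; zero; suc)
open import Data.List using (List; []; _∷_; _++_)
open import Data.Unit using (⊤)
open import Data.Product using (_×_)
open import Relation.Binary.PropositionalEquality using (_≡_)

data Letter : Set where
  a b : Letter

Word : Set
Word = List Letter

data State : Set where
  s00 s10 s20 s11 s12 s21 s22 : State

record Step : Set where
  constructor _,_
  field
    next : State
    out  : Word
open Step public

δ : State → Letter → Step
δ s00 a = s10 , []
δ s00 b = s11 , []
δ s10 a = s20 , []
δ s10 b = s21 , []
δ s20 a = s11 , []
δ s20 b = s12 , []
δ s11 a = s21 , []
δ s11 b = s22 , []
δ s21 a = s12 , (a ∷ [])
δ s21 b = s11 , (a ∷ b ∷ [])
δ s12 a = s22 , []
δ s12 b = s21 , (b ∷ [])
δ s22 a = s11 , (b ∷ a ∷ [])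
δ s22 b = s12 , (b ∷ a ∷ [])

run : State → Word → Word
run q [] = []
run q (x ∷ u) = out (δ q x) ++ run (next (δ q x)) u

t : Word → Word
t = run s00

iter : ℕ → Word → Word
iter zero u = u
iter (suc n) u = t (iter n u)

abω : ℕ → Letter
abω zero = a
abω (suc zero) = b
abω (suc (suc i)) = abω i

PrefixFrom : ℕ → (ℕ → Letter) → Word → Set
PrefixFrom i f [] = ⊤
PrefixFrom i f (x ∷ w) = (x ≡ f i) × PrefixFrom (suc i) f w

IsPrefixOfABω : Word → Set
IsPrefixOfABω = PrefixFrom zero abω

module Submission where

-- Read a word as a walk on ℤ: a steps up, b steps down.  Then t divides
-- heights by four up to a bounded error.  Refining the states of t by an
-- offset D (eleven reachable pairs, 'Offset'), a check of each transition
-- shows that after an input prefix of height h the output has height y with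
-- 4y = h + D, and that every output prefix emitted meanwhile has
-- 4y ∈ [h - 6, h + 4] ('track').  So if the heights of u lie in [lo, hi],
-- those of t u lie in about [lo/4, hi/4] ('contraction'); on symmetric
-- intervals t halves every radius of at least 4 ('halving').
-- A word of length k has heights in [-2^(L+1), 2^(L+1)], L = ⌊log₂ k⌋, so L
-- steps bring them into [-2, 2] and one more into [-2, 1].  There the
-- contraction estimate stalls, but on such walks t can be simulated exactly:
-- two more steps give [-1, 1] and then [0, 1] ('Endgame').  A walk confined
-- to [0, 1] alternates a and b, i.e. is a prefix of (ab)^ω.  Hence
-- n(k) = ⌊log₂ k⌋ + 3 works, and n(k) ≤ 4⌊log₂ k⌋ once k ≥ 2.

open import Defs
open import Data.Nat as ℕ using (ℕ; zero; suc; z≤n; s≤s)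
import Data.Nat.Properties as ℕ
open import Data.Nat.Logarithm using (⌊log₂_⌋; ⌊log₂⌋-mono-≤; ⌊log₂[2^n]⌋≡n)
open import Data.Integer using (+_)
open import Data.List using ([]; _∷_; _++_; length)
open import Data.Product using (Σ; _×_; _,_)
open import Data.Unit using (⊤; tt)
open import Data.Empty using (⊥-elim)
open import Relation.Nullary using (Dec; yes; no; ¬_)
open import Relation.Nullary.Decidable using (True; False; toWitness; toWitnessFalse; _×-dec_)
open import Relation.Binary.PropositionalEquality using (_≡_; refl; sym; trans; cong; subst; module ≡-Reasoning)

-- Words as walks on ℤ, and properties of all the heights a walk visits.
module Walk where
  open import Data.Integer using (ℤ; +_; -[1+_]; -_; _+_; _≤_; ∣_∣; +≤+; -≤+)
  open import Data.Integer.Properties using (_≤?_; +-assoc; +-identityʳ; neg-≤-pos; neg-mono-≤; ∣i+j∣≤∣i∣+∣j∣)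

  weight : Letter → ℤ
  weight a = + 1
  weight b = - + 1

  height : Word → ℤ
  height [] = + 0
  height (x ∷ w) = weight x + height w

  AllHeights : (ℤ → Set) → ℤ → Word → Set
  AllHeights P h [] = ⊤
  AllHeights P h (x ∷ w) = P (h + weight x) × AllHeights P (h + weight x) w

  AllHeights-mono : ∀ {P Q : ℤ → Set} → (∀ {z} → P z → Q z) →
                    ∀ {h} w → AllHeights P h w → AllHeights Q h w
  AllHeights-mono f [] _ = tt
  AllHeights-mono f (x ∷ w) (p , ps) = f p , AllHeights-mono f w ps

  AllHeights-shift : ∀ {P Q : ℤ → Set} c → (∀ {z} → P z → Q (c + z)) →
                     ∀ {h} w → AllHeights P h w → AllHeights Q (c + h) w
  AllHeights-shift c f [] _ = tt
  AllHeights-shift {Q = Q} c f {h} (x ∷ w) (p , ps) =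
    subst Q shifted (f p) , subst (λ g → AllHeights Q g w) shifted (AllHeights-shift c f w ps)
    where
      shifted : c + (h + weight x) ≡ c + h + weight x
      shifted = sym (+-assoc c h (weight x))

  AllHeights-++ : ∀ {P : ℤ → Set} {h} v {w} →
                  AllHeights P h v → AllHeights P (h + height v) w → AllHeights P h (v ++ w)
  AllHeights-++ {P} {h} [] {w} _ ps = subst (λ g → AllHeights P g w) (+-identityʳ h) ps
  AllHeights-++ {P} {h} (x ∷ v) {w} (p , ps) qs =
    p , AllHeights-++ v ps (subst (λ g → AllHeights P g w) (sym (+-assoc h (weight x) (height v))) qs)

  allHeights? : ∀ {P : ℤ → Set} → (∀ z → Dec (P z)) → ∀ h w → Dec (AllHeights P h w)
  allHeights? P? h [] = yes tt
  allHeights? P? h (x ∷ w) = P? (h + weight x) ×-dec allHeights? P? (h + weight x) w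

  infix 4 _∈[_,_] _∈[_,_]?

  _∈[_,_] : ℤ → ℤ → ℤ → Set
  z ∈[ l , u ] = l ≤ z × z ≤ u

  _∈[_,_]? : ∀ z l u → Dec (z ∈[ l , u ])
  z ∈[ l , u ]? = (l ≤? z) ×-dec (z ≤? u)

  Within : ℕ → ℤ → Set
  Within r z = z ∈[ - + r , + r ]

  ≤-by-eval : ∀ {i j} {p : True (i ≤? j)} → i ≤ j
  ≤-by-eval {p = p} = toWitness p

  ≰-by-eval : ∀ {i j} {p : False (i ≤? j)} → ¬ i ≤ j
  ≰-by-eval {p = p} = toWitnessFalse p

  ∈-by-eval : ∀ {z l u} {p : True (z ∈[ l , u ]?)} → z ∈[ l , u ]
  ∈-by-eval {p = p} = toWitness p

  ∣∣≤⇒Within : ∀ {r} z → ∣ z ∣ ℕ.≤ r → Within r z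
  ∣∣≤⇒Within (+ n) n≤r = neg-≤-pos , +≤+ n≤r
  ∣∣≤⇒Within -[1+ n ] n<r = neg-mono-≤ (+≤+ n<r) , -≤+

  one-step : ∀ h x → ∣ h + weight x ∣ ℕ.≤ suc ∣ h ∣
  one-step h x = subst (∣ h + weight x ∣ ℕ.≤_) ∣h∣+1≡ (∣i+j∣≤∣i∣+∣j∣ h (weight x))
    where
      ∣weight∣ : ∀ y → ∣ weight y ∣ ≡ 1
      ∣weight∣ a = refl
      ∣weight∣ b = refl
      ∣h∣+1≡ : ∣ h ∣ ℕ.+ ∣ weight x ∣ ≡ suc ∣ h ∣
      ∣h∣+1≡ = trans (cong (∣ h ∣ ℕ.+_) (∣weight∣ x)) (ℕ.+-comm ∣ h ∣ 1)

  length-bound : ∀ h w → AllHeights (λ z → ∣ z ∣ ℕ.≤ ∣ h ∣ ℕ.+ length w) h w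
  length-bound h [] = tt
  length-bound h (x ∷ w) =
    ℕ.≤-trans (one-step h x) first ,
    AllHeights-mono (λ p → ℕ.≤-trans p rest) w (length-bound (h + weight x) w)
    where
      bound≡ : suc (∣ h ∣ ℕ.+ length w) ≡ ∣ h ∣ ℕ.+ suc (length w)
      bound≡ = sym (ℕ.+-suc ∣ h ∣ (length w))
      first : suc ∣ h ∣ ℕ.≤ ∣ h ∣ ℕ.+ suc (length w)
      first = subst (suc ∣ h ∣ ℕ.≤_) bound≡ (s≤s (ℕ.m≤m+n ∣ h ∣ (length w)))
      rest : ∣ h + weight x ∣ ℕ.+ length w ℕ.≤ ∣ h ∣ ℕ.+ suc (length w)
      rest = subst (∣ h + weight x ∣ ℕ.+ length w ℕ.≤_) bound≡ (ℕ.+-monoˡ-≤ (length w) (one-step h x))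

  word-within : ∀ {r} u → length u ℕ.≤ r → AllHeights (Within r) (+ 0) u
  word-within u k≤r = AllHeights-mono (λ {z} p → ∣∣≤⇒Within z (ℕ.≤-trans p k≤r)) u (length-bound (+ 0) u)

-- The offset invariant of t and the resulting contraction of heights.
module Tracking where
  open Walk
  open import Data.Integer using (ℤ; +_; -_; _+_; _-_; _*_; _≤_; _<_; +≤+)
  open import Data.Integer.Properties
    using (≤-refl; ≤-<-trans; +-assoc; +-identityʳ; +-mono-≤; +-monoˡ-≤; *-distribˡ-+; *-cancelˡ-<-nonNeg;
           suc[i]≤j⇒i<j; i<j⇒i≤pred[j]; pred-suc; pos-*; neg-≤-pos; neg-mono-≤; neg-distrib-+; neg-distribʳ-*;
           module ≤-Reasoning)
  open import Data.Integer.Tactic.RingSolver using (solve-∀)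

  -- Offset q D: the state q is reached together with the offset D, meaning
  -- that four times the output height equals the input height plus D.
  -- States 00, 10, 20 carry one offset, the other four states two offsets
  -- differing by 4 (the output is one letter ahead in the high variant).
  data Offset : State → ℤ → Set where
    o00 : Offset s00 (+ 0)
    o10 : Offset s10 (- + 1)
    o20 : Offset s20 (- + 2)
    o11-low : Offset s11 (- + 3)
    o11-high : Offset s11 (+ 1)
    o12-low : Offset s12 (- + 1)
    o12-high : Offset s12 (+ 3)
    o21-low : Offset s21 (- + 4)
    o21-high : Offset s21 (+ 0)
    o22-low : Offset s22 (- + 2)
    o22-high : Offset s22 (+ 2)

  -- while a transition leaving offset D emits its output, each partial
  -- output height z keeps D + 4z in [-6, 4]
  Emission : ℤ → ℤ → Set
  Emission D z = D + + 4 * z ∈[ - + 6 , + 4 ]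

  record Transition (q : State) (D : ℤ) (x : Letter) : Set where
    constructor _,_
    field
      offset′ : Offset (next (δ q x)) (D + + 4 * height (out (δ q x)) - weight x)
      emitted : AllHeights (Emission D) (+ 0) (out (δ q x))

  goto : ∀ {q D x} → Offset (next (δ q x)) (D + + 4 * height (out (δ q x)) - weight x) →
         {p : True (allHeights? (λ z → D + + 4 * z ∈[ - + 6 , + 4 ]?) (+ 0) (out (δ q x)))} →
         Transition q D x
  goto o′ {p} = o′ , toWitness p

  transition : ∀ {q D} → Offset q D → ∀ x → Transition q D x
  transition o00 a = goto o10
  transition o00 b = goto o11-high
  transition o10 a = goto o20
  transition o10 b = goto o21-high
  transition o20 a = goto o11-low
  transition o20 b = goto o12-low
  transition o11-low a = goto o21-low
  transition o11-low b = goto o22-low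
  transition o11-high a = goto o21-high
  transition o11-high b = goto o22-high
  transition o12-low a = goto o22-low
  transition o12-low b = goto o21-low
  transition o12-high a = goto o22-high
  transition o12-high b = goto o21-high
  transition o21-low a = goto o12-low
  transition o21-low b = goto o11-low
  transition o21-high a = goto o12-high
  transition o21-high b = goto o11-high
  transition o22-low a = goto o11-low
  transition o22-low b = goto o12-low
  transition o22-high a = goto o11-high
  transition o22-high b = goto o12-high

  four-shift : ∀ {y} h D z → + 4 * y ≡ h + D → + 4 * (y + z) ≡ h + (D + + 4 * z)
  four-shift {y} h D z inv = begin
    + 4 * (y + z)      ≡⟨ *-distribˡ-+ (+ 4) y z ⟩
    + 4 * y + + 4 * z  ≡⟨ cong (_+ + 4 * z) inv ⟩
    h + D + + 4 * z    ≡⟨ +-assoc h D (+ 4 * z) ⟩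
    h + (D + + 4 * z)  ∎
    where open ≡-Reasoning

  rebalance : ∀ h E s → h + E ≡ (h + s) + (E - s)
  rebalance = solve-∀

  -- the interval into which t maps walks confined to [lo, hi], scaled by 4
  ImageBand : ℤ → ℤ → ℤ → Set
  ImageBand lo hi z = + 4 * z ∈[ lo - + 6 , hi + + 4 ]

  emitted-in-band : ∀ {lo hi y h D z} → h ∈[ lo , hi ] → + 4 * y ≡ h + D → Emission D z →
                    ImageBand lo hi (y + z)
  emitted-in-band {lo} {hi} {_} {h} {D} {z} (lo≤h , h≤hi) inv (low , high) =
    subst (_∈[ lo - + 6 , hi + + 4 ]) (sym (four-shift h D z inv)) (+-mono-≤ lo≤h low , +-mono-≤ h≤hi high)

  track : ∀ {lo hi q D y h} → Offset q D → + 4 * y ≡ h + D → h ∈[ lo , hi ] →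
          ∀ u → AllHeights (_∈[ lo , hi ]) h u → AllHeights (ImageBand lo hi) y (run q u)
  track o inv h∈ [] _ = tt
  track {lo} {hi} {q} {D} {y} {h} o inv h∈ (x ∷ u) (h′∈ , rest) =
    AllHeights-++ (out (δ q x)) emitted′ (track offset′ inv′ h′∈ u rest)
    where
      open Transition (transition o x)
      emitted′ : AllHeights (ImageBand lo hi) y (out (δ q x))
      emitted′ = subst (λ g → AllHeights (ImageBand lo hi) g (out (δ q x))) (+-identityʳ y)
                   (AllHeights-shift y (emitted-in-band h∈ inv) (out (δ q x)) emitted)
      inv′ : + 4 * (y + height (out (δ q x))) ≡ (h + weight x) + (D + + 4 * height (out (δ q x)) - weight x)
      inv′ = trans (four-shift h D (height (out (δ q x))) inv)
                   (rebalance h (D + + 4 * height (out (δ q x))) (weight x))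

  quarter : ∀ {i j} → + 4 * i ≤ + 4 * j + + 3 → i ≤ j
  quarter {i} {j} 4i≤4j+3 = subst (i ≤_) (pred-suc j) (i<j⇒i≤pred[j] (*-cancelˡ-<-nonNeg (+ 4) 4i<4[j+1]))
    where
      4j+4≡ : ∀ n → + 1 + (+ 4 * n + + 3) ≡ + 4 * (+ 1 + n)
      4j+4≡ = solve-∀
      4i<4[j+1] : + 4 * i < + 4 * (+ 1 + j)
      4i<4[j+1] = ≤-<-trans 4i≤4j+3 (subst (+ 4 * j + + 3 <_) (4j+4≡ j) (suc[i]≤j⇒i<j ≤-refl))

  contraction : ∀ {lo hi lo′ hi′} → + 0 ∈[ lo , hi ] → + 4 * lo′ ≤ lo - + 3 → hi + + 1 ≤ + 4 * hi′ →
                ∀ u → AllHeights (_∈[ lo , hi ]) (+ 0) u → AllHeights (_∈[ lo′ , hi′ ]) (+ 0) (t u)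
  contraction {lo} {hi} {lo′} {hi′} 0∈ lo′-ok hi′-ok u hs =
    AllHeights-mono narrow (t u) (track o00 refl 0∈ u hs)
    where
      open ≤-Reasoning
      lower≡ : ∀ l → l - + 3 ≡ l - + 6 + + 3
      lower≡ = solve-∀
      upper≡ : ∀ h → h + + 4 ≡ h + + 1 + + 3
      upper≡ = solve-∀
      narrow : ∀ {z} → ImageBand lo hi z → z ∈[ lo′ , hi′ ]
      narrow {z} (low , high) =
        quarter (begin
          + 4 * lo′        ≤⟨ lo′-ok ⟩
          lo - + 3         ≡⟨ lower≡ lo ⟩
          lo - + 6 + + 3   ≤⟨ +-monoˡ-≤ (+ 3) low ⟩
          + 4 * z + + 3    ∎) ,
        quarter (begin
          + 4 * z          ≤⟨ high ⟩
          hi + + 4         ≡⟨ upper≡ hi ⟩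
          hi + + 1 + + 3   ≤⟨ +-monoˡ-≤ (+ 3) hi′-ok ⟩
          + 4 * hi′ + + 3  ∎)

  halving : ∀ {s} → 2 ℕ.≤ s → ∀ u → AllHeights (Within (2 ℕ.* s)) (+ 0) u → AllHeights (Within s) (+ 0) (t u)
  halving {s} 2≤s = contraction (neg-≤-pos , +≤+ z≤n) lower upper
    where
      2s+3≤4s : 2 ℕ.* s ℕ.+ 3 ℕ.≤ 4 ℕ.* s
      2s+3≤4s = subst (2 ℕ.* s ℕ.+ 3 ℕ.≤_) (sym (ℕ.*-distribʳ-+ s 2 2))
                  (ℕ.+-monoʳ-≤ (2 ℕ.* s) (ℕ.≤-trans (ℕ.n≤1+n 3) (ℕ.*-monoʳ-≤ 2 2≤s)))
      lower : + 4 * - + s ≤ - + (2 ℕ.* s) - + 3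
      lower = begin
        + 4 * - + s               ≡⟨ neg-distribʳ-* (+ 4) (+ s) ⟨
        - (+ 4 * + s)             ≡⟨ cong -_ (pos-* 4 s) ⟨
        - + (4 ℕ.* s)             ≤⟨ neg-mono-≤ (+≤+ 2s+3≤4s) ⟩
        - + (2 ℕ.* s ℕ.+ 3)       ≡⟨ neg-distrib-+ (+ (2 ℕ.* s)) (+ 3) ⟩
        - + (2 ℕ.* s) - + 3       ∎
        where open ≤-Reasoning
      upper : + (2 ℕ.* s) + + 1 ≤ + 4 * + s
      upper = subst (+ (2 ℕ.* s ℕ.+ 1) ≤_) (pos-* 4 s) (+≤+ (ℕ.≤-trans (ℕ.+-monoʳ-≤ (2 ℕ.* s) (s≤s z≤n)) 2s+3≤4s))

  -- radius 2 is below the reach of 'halving', but t still moves [-2, 2] into [-2, 1]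
  to-[-2,1] : ∀ u → AllHeights (Within 2) (+ 0) u → AllHeights (_∈[ - + 2 , + 1 ]) (+ 0) (t u)
  to-[-2,1] = contraction ∈-by-eval ≤-by-eval ≤-by-eval

-- Exact simulation of t on walks in the narrow bands [-2, 1] and [-1, 1],
-- where the input height in each state is forced and the offset estimate
-- of 'Tracking' is too coarse; then the final alternation argument.
module Endgame where
  open Walk
  open import Data.Integer using (ℤ; +_; -_)

  -- On input heights in [-2, 1] the input height in each state is forced
  -- (00: 0, 10: 1, 11: -1, 12: 1, 21: 0, 22: -2) and the output height is 1
  -- in state 12 and 0 elsewhere; the output drops to -1 only inside state 22.
  module [-2,1]→[-1,1] where
    In Out : ℤ → Set
    In = _∈[ - + 2 , + 1 ]
    Out = _∈[ - + 1 , + 1 ]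

    from00 : ∀ u → AllHeights In (+ 0) u → AllHeights Out (+ 0) (run s00 u)
    from10 : ∀ u → AllHeights In (+ 1) u → AllHeights Out (+ 0) (run s10 u)
    from11 : ∀ u → AllHeights In (- + 1) u → AllHeights Out (+ 0) (run s11 u)
    from12 : ∀ u → AllHeights In (+ 1) u → AllHeights Out (+ 1) (run s12 u)
    from21 : ∀ u → AllHeights In (+ 0) u → AllHeights Out (+ 0) (run s21 u)
    from22 : ∀ u → AllHeights In (- + 2) u → AllHeights Out (+ 0) (run s22 u)

    from00 [] _ = tt
    from00 (a ∷ u) (_ , hs) = from10 u hs
    from00 (b ∷ u) (_ , hs) = from11 u hs
    from10 [] _ = tt
    from10 (a ∷ u) ((_ , 2≤1) , _) = ⊥-elim (≰-by-eval 2≤1)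
    from10 (b ∷ u) (_ , hs) = from21 u hs
    from11 [] _ = tt
    from11 (a ∷ u) (_ , hs) = from21 u hs
    from11 (b ∷ u) (_ , hs) = from22 u hs
    from12 [] _ = tt
    from12 (a ∷ u) ((_ , 2≤1) , _) = ⊥-elim (≰-by-eval 2≤1)
    from12 (b ∷ u) (_ , hs) = ∈-by-eval , from21 u hs
    from21 [] _ = tt
    from21 (a ∷ u) (_ , hs) = ∈-by-eval , from12 u hs
    from21 (b ∷ u) (_ , hs) = ∈-by-eval , ∈-by-eval , from11 u hs
    from22 [] _ = tt
    from22 (a ∷ u) (_ , hs) = ∈-by-eval , ∈-by-eval , from11 u hs
    from22 (b ∷ u) ((-2≤-3 , _) , _) = ⊥-elim (≰-by-eval -2≤-3)

  to-[-1,1] : ∀ u → AllHeights (_∈[ - + 2 , + 1 ]) (+ 0) u → AllHeights (_∈[ - + 1 , + 1 ]) (+ 0) (t u)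
  to-[-1,1] = [-2,1]→[-1,1].from00

  -- On [-1, 1] state 22 is never entered, so the output no longer drops below 0.
  module [-1,1]→[0,1] where
    In Out : ℤ → Set
    In = _∈[ - + 1 , + 1 ]
    Out = _∈[ + 0 , + 1 ]

    from00 : ∀ u → AllHeights In (+ 0) u → AllHeights Out (+ 0) (run s00 u)
    from10 : ∀ u → AllHeights In (+ 1) u → AllHeights Out (+ 0) (run s10 u)
    from11 : ∀ u → AllHeights In (- + 1) u → AllHeights Out (+ 0) (run s11 u)
    from12 : ∀ u → AllHeights In (+ 1) u → AllHeights Out (+ 1) (run s12 u)
    from21 : ∀ u → AllHeights In (+ 0) u → AllHeights Out (+ 0) (run s21 u)

    from00 [] _ = tt
    from00 (a ∷ u) (_ , hs) = from10 u hs
    from00 (b ∷ u) (_ , hs) = from11 u hs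
    from10 [] _ = tt
    from10 (a ∷ u) ((_ , 2≤1) , _) = ⊥-elim (≰-by-eval 2≤1)
    from10 (b ∷ u) (_ , hs) = from21 u hs
    from11 [] _ = tt
    from11 (a ∷ u) (_ , hs) = from21 u hs
    from11 (b ∷ u) ((-1≤-2 , _) , _) = ⊥-elim (≰-by-eval -1≤-2)
    from12 [] _ = tt
    from12 (a ∷ u) ((_ , 2≤1) , _) = ⊥-elim (≰-by-eval 2≤1)
    from12 (b ∷ u) (_ , hs) = ∈-by-eval , from21 u hs
    from21 [] _ = tt
    from21 (a ∷ u) (_ , hs) = ∈-by-eval , from12 u hs
    from21 (b ∷ u) (_ , hs) = ∈-by-eval , ∈-by-eval , from11 u hs

  to-[0,1] : ∀ u → AllHeights (_∈[ - + 1 , + 1 ]) (+ 0) u → AllHeights (_∈[ + 0 , + 1 ]) (+ 0) (t u)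
  to-[0,1] = [-1,1]→[0,1].from00

  module Alternation where
    Band : ℤ → Set
    Band = _∈[ + 0 , + 1 ]

    at-a : ∀ i w → abω i ≡ a → abω (suc i) ≡ b → AllHeights Band (+ 0) w → PrefixFrom i abω w
    at-b : ∀ i w → abω i ≡ b → abω (suc i) ≡ a → AllHeights Band (+ 1) w → PrefixFrom i abω w

    at-a i [] _ _ _ = tt
    at-a i (a ∷ w) is-a next-b (_ , hs) = sym is-a , at-b (suc i) w next-b is-a hs
    at-a i (b ∷ w) _ _ ((0≤-1 , _) , _) = ⊥-elim (≰-by-eval 0≤-1)
    at-b i [] _ _ _ = tt
    at-b i (a ∷ w) _ _ ((_ , 2≤1) , _) = ⊥-elim (≰-by-eval 2≤1)
    at-b i (b ∷ w) is-b next-a (_ , hs) = sym is-b , at-a (suc i) w next-a is-b hs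

  alternates : ∀ w → AllHeights (_∈[ + 0 , + 1 ]) (+ 0) w → IsPrefixOfABω w
  alternates w = Alternation.at-a 0 w refl refl

open import Data.Nat using (_≤_; _<_; _+_; _*_; _^_)
open Walk using (AllHeights; Within; word-within)
open Tracking using (halving; to-[-2,1])
open Endgame using (to-[-1,1]; to-[0,1]; alternates)

iter-suc : ∀ n u → iter (suc n) u ≡ iter n (t u)
iter-suc zero u = refl
iter-suc (suc n) u = cong t (iter-suc n u)

iterate-down : (S : ℕ → Word → Set) → (∀ j u → S (suc j) u → S j (t u)) → ∀ n u → S n u → S 0 (iter n u)
iterate-down S step zero u s = s
iterate-down S step (suc n) u s = subst (S 0) (sym (iter-suc n u)) (iterate-down S step n (t u) (step n u s))

descent : ∀ n u → AllHeights (Within (2 ^ suc n)) (+ 0) u → AllHeights (Within 2) (+ 0) (iter n u)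
descent = iterate-down (λ j → AllHeights (Within (2 ^ suc j)) (+ 0)) (λ j → halving (2≤2^suc j))
  where
    2≤2^suc : ∀ j → 2 ≤ 2 ^ suc j
    2≤2^suc j = ℕ.*-monoʳ-≤ 2 (ℕ.m^n>0 2 j)

-- k < 2^(⌊log₂ k⌋ + 1): otherwise monotonicity of ⌊log₂⌋ would give ⌊log₂ k⌋ + 1 ≤ ⌊log₂ k⌋
k<2^suc⌊log₂k⌋ : ∀ k → k < 2 ^ suc ⌊log₂ k ⌋
k<2^suc⌊log₂k⌋ k with 2 ^ suc ⌊log₂ k ⌋ ℕ.≤? k
... | no 2^L+1≰k = ℕ.≰⇒> 2^L+1≰k
... | yes 2^L+1≤k = ⊥-elim (ℕ.<-irrefl refl L+1≤L)
  where
    L+1≤L : suc ⌊log₂ k ⌋ ≤ ⌊log₂ k ⌋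
    L+1≤L = subst (_≤ ⌊log₂ k ⌋) (⌊log₂[2^n]⌋≡n (suc ⌊log₂ k ⌋)) (⌊log₂⌋-mono-≤ 2^L+1≤k)

log-bound : ∀ k → 2 ≤ k → 3 + ⌊log₂ k ⌋ ≤ 4 * ⌊log₂ k ⌋
log-bound k 2≤k = subst (_≤ 4 * L) (ℕ.+-comm L 3) (ℕ.+-monoʳ-≤ L (ℕ.*-monoʳ-≤ 3 1≤L))
  where
    L : ℕ
    L = ⌊log₂ k ⌋
    1≤L : 1 ≤ L
    1≤L = subst (_≤ L) (⌊log₂[2^n]⌋≡n 1) (⌊log₂⌋-mono-≤ 2≤k)

reaches-abω : ∀ k (u : Word) → length u ≡ k → IsPrefixOfABω (iter (3 + ⌊log₂ k ⌋) u)
reaches-abω k u refl =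
  alternates _ (to-[0,1] _ (to-[-1,1] _ (to-[-2,1] _ (descent L u (word-within u k≤2^L+1)))))
  where
    L : ℕ
    L = ⌊log₂ length u ⌋
    k≤2^L+1 : length u ≤ 2 ^ suc L
    k≤2^L+1 = ℕ.<⇒≤ (k<2^suc⌊log₂k⌋ (length u))

lemma3 : Σ (ℕ → ℕ) λ n →
           (Σ ℕ λ C → Σ ℕ λ K → ∀ k → K ≤ k → n k ≤ C * ⌊log₂ k ⌋)
           × (∀ k (u : Word) → length u ≡ k → IsPrefixOfABω (iter (n k) u))
lemma3 = (λ k → 3 + ⌊log₂ k ⌋) , (4 , 2 , log-bound) , reaches-abω
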